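{- Let $Q=C\vee A\vee D$ be a query clause, where $C$ and $D$ are subclauses and $A$ is a literal, such that $A$ contains both an isolated variable and a chained variable of $Q$, $\mathrm{Var}(C)\subseteq\mathrm{Var}(A)$, and $\bar x$ lists the variables of $\mathrm{Var}(A)\cap\mathrm{Var}(D)$. Let $d_s$ be a fresh predicate symbol. Then $C\vee A\vee d_s(\bar x)$ is a guarded clause and $\neg d_s(\bar x)\vee D$ is a query clause.
   Context: Clauses are finite multisets of literals without equality; $\mathrm{Var}(E)$ is the set of variables of $E$. A literal is flat if each argument is a variable or constant. A query clause is a flat clause all of whose literals are negative. A clause is covering if every compound term (term that is neither variable nor constant) $t$ in it satisfies $\mathrm{Var}(t)=\mathrm{Var}(C)$; it is simple if each argument of each literal is a variable, constant, or $f(u_1,\dots,u_n)$ with each $u_i$ a variable or constant. A guarded clause is an equality-free, simple, covering clause $C$ that is ground or contains a negative flat literal $\neg G$ with $\mathrm{Var}(G)=\mathrm{Var}(C)$. A literal $L$ of a query clause $Q$ is a surface literal if there is no literal $L'$ of $Q$ distinct from $L$ with $\mathrm{Var}(L)\subsetneq\mathrm{Var}(L')$. If $L_1,\dots,L_n$ ($n>1$) are the surface literals of $Q$, the chained variables of $Q$ are the variables in $\mathrm{Var}(L_i)\cap\mathrm{Var}(L_j)$ for pairs $i,j$ with $\mathrm{Var}(L_i)\neq\mathrm{Var}(L_j)$; all other variables of $Q$ are isolated. -}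

module Defs where

open import Data.Nat using (ℕ)
open import Data.Bool using (Bool; true; false)
open import Data.List using (List; []; _∷_; _++_; map)
open import Data.List.Relation.Unary.All using (All)
open import Data.List.Membership.Propositional using (_∈_)
open import Data.Product using (Σ; _×_; _,_; ∃-syntax)
open import Data.Sum using (_⊎_)
open import Data.Empty using (⊥)
open import Relation.Nullary using (¬_)
open import Relation.Binary.PropositionalEquality using (_≡_; _≢_)

-- The language has no equality predicate,
-- so every clause below is equality-free by construction.
Variable : Set
Variable = ℕ

data Term : Set where
  var   : Variable → Term
  const : ℕ → Term
  fn    : ℕ → List Term → Term

record Literal : Set where
  constructor lit
  field
    positive : Bool
    pred     : ℕ
    args     : List Term
open Literal public

-- Clause: a finite multiset of literals, represented as a list.
Clause : Set
Clause = List Literal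

mutual
  data _∈Vt_ (x : Variable) : Term → Set where
    here : x ∈Vt var x
    inFn : ∀ {f ts} → x ∈Vts ts → x ∈Vt fn f ts

  data _∈Vts_ (x : Variable) : List Term → Set where
    hd : ∀ {t ts} → x ∈Vt t → x ∈Vts (t ∷ ts)
    tl : ∀ {t ts} → x ∈Vts ts → x ∈Vts (t ∷ ts)

_∈VL_ : Variable → Literal → Set
x ∈VL L = x ∈Vts args L

_∈VC_ : Variable → Clause → Set
x ∈VC C = ∃[ L ] (L ∈ C × x ∈VL L)

_⊆V_ : (Variable → Set) → (Variable → Set) → Set
P ⊆V R = ∀ x → P x → R x

_≐V_ : (Variable → Set) → (Variable → Set) → Set
P ≐V R = P ⊆V R × R ⊆V P

VarT : Term → Variable → Set
VarT t x = x ∈Vt t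

VarL : Literal → Variable → Set
VarL L x = x ∈VL L

VarC : Clause → Variable → Set
VarC C x = x ∈VC C

mutual
  data _⊑t_ (s : Term) : Term → Set where
    refl⊑ : s ⊑t s
    inArg : ∀ {f ts} → s ⊑ts ts → s ⊑t fn f ts

  data _⊑ts_ (s : Term) : List Term → Set where
    hd : ∀ {t ts} → s ⊑t t → s ⊑ts (t ∷ ts)
    tl : ∀ {t ts} → s ⊑ts ts → s ⊑ts (t ∷ ts)

_occursIn_ : Term → Clause → Set
t occursIn C = ∃[ L ] (L ∈ C × t ⊑ts args L)

IsVarOrConst : Term → Set
IsVarOrConst (var _)   = Data.Unit.⊤ where import Data.Unit
IsVarOrConst (const _) = Data.Unit.⊤ where import Data.Unit
IsVarOrConst (fn _ _)  = ⊥

IsCompound : Term → Set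
IsCompound (fn _ _) = Data.Unit.⊤ where import Data.Unit
IsCompound _        = ⊥

IsSimpleArg : Term → Set
IsSimpleArg (var _)    = Data.Unit.⊤ where import Data.Unit
IsSimpleArg (const _)  = Data.Unit.⊤ where import Data.Unit
IsSimpleArg (fn _ us)  = All IsVarOrConst us

IsNegative : Literal → Set
IsNegative L = positive L ≡ false

FlatLit : Literal → Set
FlatLit L = All IsVarOrConst (args L)

FlatClause : Clause → Set
FlatClause C = All FlatLit C

QueryClause : Clause → Set
QueryClause Q = FlatClause Q × All IsNegative Q

Covering : Clause → Set
Covering C = ∀ t → t occursIn C → IsCompound t → VarT t ≐V VarC C

Simple : Clause → Set
Simple C = All (λ L → All IsSimpleArg (args L)) C

Ground : Clause → Set
Ground C = ∀ x → ¬ (x ∈VC C)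

-- Equality-freeness holds by construction (no equality predicate).
GuardedClause : Clause → Set
GuardedClause C =
  Simple C × Covering C ×
  (Ground C ⊎ (∃[ G ] (G ∈ C × IsNegative G × FlatLit G × VarL G ≐V VarC C)))

StrictSub : (Variable → Set) → (Variable → Set) → Set
StrictSub P R = P ⊆V R × ¬ (R ⊆V P)

SurfaceLiteral : Clause → Literal → Set
SurfaceLiteral Q L =
  L ∈ Q × (∀ L' → L' ∈ Q → ¬ StrictSub (VarL L) (VarL L'))

Chained : Clause → Variable → Set
Chained Q x =
  ∃[ L₁ ] ∃[ L₂ ] (SurfaceLiteral Q L₁ × SurfaceLiteral Q L₂ ×
                   ¬ (VarL L₁ ≐V VarL L₂) × x ∈VL L₁ × x ∈VL L₂)

Isolated : Clause → Variable → Set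
Isolated Q x = x ∈VC Q × ¬ Chained Q x

PredOccurs : ℕ → Clause → Set
PredOccurs p C = ∃[ L ] (L ∈ C × pred L ≡ p)

module Submission where

-- Both clauses produced by the split are flat: C ∨ A comes from
-- the flat query clause Q, and the new literal d_s(x̄) has only variables as
-- arguments.  A flat clause contains no compound terms, so it is trivially
-- simple and (vacuously) covering.  Hence a flat clause is guarded as soon as
-- one of its negative literals contains all of its variables.  For
-- C ∨ A ∨ d_s(x̄) the guard is A itself: Var(C) ⊆ Var(A) by hypothesis, and
-- Var(d_s(x̄)) = Var(A) ∩ Var(D) ⊆ Var(A).  The second clause ¬d_s(x̄) ∨ D is
-- flat and negative because D is.

open import Defs
open import Data.Nat using (ℕ)
open import Data.Bool using (true; false)
open import Data.List using (List; []; _∷_; _++_; map)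
open import Data.List.Membership.Propositional using (_∈_)
open import Data.List.Membership.Propositional.Properties using (∈-++⁻; ∈-++⁺ʳ)
open import Data.List.Relation.Unary.All as All using (All; []; _∷_)
import Data.List.Relation.Unary.All.Properties as All
open import Data.List.Relation.Unary.Any using (here; there)
open import Data.List.Relation.Unary.Unique.Propositional using (Unique)
open import Data.Product using (_×_; ∃-syntax; _,_; proj₁)
open import Data.Sum using (_⊎_; inj₁; inj₂)
open import Data.Empty using (⊥-elim)
open import Data.Unit using (tt)
open import Relation.Nullary using (¬_)
open import Relation.Binary.PropositionalEquality using (refl)
open import Function.Bundles using (_⇔_; Equivalence)

varOrConst⇒simpleArg : ∀ {t} → IsVarOrConst t → IsSimpleArg t
varOrConst⇒simpleArg {var _}   _ = tt
varOrConst⇒simpleArg {const _} _ = tt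

flat⇒simple : ∀ {K} → FlatClause K → Simple K
flat⇒simple = All.map (All.map varOrConst⇒simpleArg)

-- A list of variables and constants has no compound subterm, so in a flat
-- clause the covering condition quantifies over nothing.
flatArgs-noCompound : ∀ {s ts} → All IsVarOrConst ts → s ⊑ts ts → ¬ IsCompound s
flatArgs-noCompound {ts = var _ ∷ _}   (_ ∷ _)  (hd refl⊑) ()
flatArgs-noCompound {ts = const _ ∷ _} (_ ∷ _)  (hd refl⊑) ()
flatArgs-noCompound                    (_ ∷ ps) (tl s⊑)    = flatArgs-noCompound ps s⊑

flat⇒covering : ∀ {K} → FlatClause K → Covering K
flat⇒covering flat t (L , L∈K , t⊑L) compound =
  ⊥-elim (flatArgs-noCompound (All.lookup flat L∈K) t⊑L compound)

flat-guarded : ∀ {K G} → FlatClause K → G ∈ K → IsNegative G →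
               VarC K ⊆V VarL G → GuardedClause K
flat-guarded {G = G} flat G∈K negG varsInG =
  flat⇒simple flat , flat⇒covering flat ,
  inj₂ (G , G∈K , negG , All.lookup flat G∈K , (λ x x∈G → G , G∈K , x∈G) , varsInG)

varArgs-flat : ∀ xs → All IsVarOrConst (map var xs)
varArgs-flat []       = []
varArgs-flat (_ ∷ xs) = tt ∷ varArgs-flat xs

varArgs-vars : ∀ {x} xs → x ∈Vts map var xs → x ∈ xs
varArgs-vars (_ ∷ _)  (hd here) = here refl
varArgs-vars (_ ∷ xs) (tl x∈)   = there (varArgs-vars xs x∈)

vars-split : ∀ {x} C L E → x ∈VC (C ++ L ∷ E) → x ∈VC C ⊎ x ∈VL L ⊎ x ∈VC E
vars-split C L E (M , M∈ , x∈M) with ∈-++⁻ C M∈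
... | inj₁ M∈C          = inj₁ (M , M∈C , x∈M)
... | inj₂ (here refl)  = inj₂ (inj₁ x∈M)
... | inj₂ (there M∈E)  = inj₂ (inj₂ (M , M∈E , x∈M))

mainTheorem14 : (C D : Clause) (A : Literal) (xs : List ℕ) (ds : ℕ) →
    QueryClause (C ++ A ∷ D) →
    (∃[ y ] (y ∈VL A × Isolated (C ++ A ∷ D) y)) →
    (∃[ z ] (z ∈VL A × Chained (C ++ A ∷ D) z)) →
    VarC C ⊆V VarL A →
    Unique xs →
    (∀ x → (x ∈ xs) ⇔ (x ∈VL A × x ∈VC D)) →
    ¬ PredOccurs ds (C ++ A ∷ D) →
    GuardedClause (C ++ A ∷ lit true ds (map var xs) ∷ [])
    × QueryClause (lit false ds (map var xs) ∷ D)
mainTheorem14 C D A xs ds (flatQ , negQ) _ _ VarC⊆VarA _ xs-spec _ =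
  flat-guarded flatK (∈-++⁺ʳ C (here refl)) (All.head negAD) varsInA ,
  (varArgs-flat xs ∷ All.tail flatAD , refl ∷ All.tail negAD)
  where
    flatAD = All.++⁻ʳ C flatQ
    negAD  = All.++⁻ʳ C negQ
    dsLit  = lit true ds (map var xs)
    flatK  = All.++⁺ (All.++⁻ˡ C flatQ) (All.head flatAD ∷ varArgs-flat xs ∷ [])

    dsVars⊆A : VarL dsLit ⊆V VarL A
    dsVars⊆A x x∈ds = proj₁ (Equivalence.to (xs-spec x) (varArgs-vars xs x∈ds))

    varsInA : VarC (C ++ A ∷ dsLit ∷ []) ⊆V VarL A
    varsInA x x∈K with vars-split C A (dsLit ∷ []) x∈K
    ... | inj₁ x∈C                          = VarC⊆VarA x x∈C
    ... | inj₂ (inj₁ x∈A)                   = x∈A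
    ... | inj₂ (inj₂ (_ , here refl , x∈ds)) = dsVars⊆A x x∈ds
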